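{- Let $A$ and $B$ be (possibly open) types of the guarded $\lambda$-calculus and $\alpha$ a type variable. (i) If $\alpha$ is guarded in $A$, then $\mathsf{us}(A[B/\alpha])\le\mathsf{us}(A)$. (ii) If $\mathsf{bd}(B)\le\mathsf{bd}(A)$, then $\mathsf{bd}(A[B/\alpha])\le\mathsf{bd}(A)$.
   Context: Types: $A ::= \alpha \mid \mathbf{N} \mid \mathbf{1} \mid A\times A \mid \mathbf{0} \mid A+A \mid A\to A \mid \mu\alpha.A \mid \blacktriangleright A \mid \blacksquare A$, with $\mu\alpha.A$ formed only when $\alpha$ is guarded in $A$ and $\blacksquare A$ only for closed $A$ (so $\blacksquare A$ has no free variables). A variable $\alpha$ is guarded in $A$ if every occurrence of $\alpha$ in $A$ lies beneath an occurrence of $\blacktriangleright$. The unguarded size $\mathsf{us}$ is the usual size of a type (number of nodes of its syntax tree) except that $\mathsf{us}(\blacktriangleright A)=0$. The box depth $\mathsf{bd}$: $\mathsf{bd}(A)=0$ for $A\in\{\alpha,\mathbf 0,\mathbf 1,\mathbf N\}$; $\mathsf{bd}(A\times B)=\min(\mathsf{bd}(A),\mathsf{bd}(B))$, and likewise for $A+B$ and $A\to B$; $\mathsf{bd}(\mu\alpha.A)=\mathsf{bd}(A)$ and $\mathsf{bd}(\blacktriangleright A)=\mathsf{bd}(A)$; $\mathsf{bd}(\blacksquare A)=\mathsf{bd}(A)+1$. -}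

module Defs where

open import Data.Nat using (ℕ; zero; suc; _+_; _⊔_; _⊓_)
open import Data.Fin using (Fin; zero; suc; punchOut)
open import Data.Fin.Properties using (_≟_)
open import Data.Unit using (⊤)
open import Data.Product using (_×_)
open import Relation.Nullary using (¬_; yes; no)
open import Relation.Binary.PropositionalEquality using (_≡_; _≢_)

-- Types of the guarded λ-calculus, in de Bruijn form, scoped by the number n
-- of free type variables.  μ binds variable 0 of its body.  □ takes a closed
-- type (Ty 0), enforcing that □A is only formed for closed A.
infixr 6 _⊗_
infixr 5 _⊕_
infixr 4 _⇒_
data Ty (n : ℕ) : Set where
  var  : Fin n → Ty n
  `N   : Ty n
  `1   : Ty n
  _⊗_  : Ty n → Ty n → Ty n
  `0   : Ty n
  _⊕_  : Ty n → Ty n → Ty n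
  _⇒_  : Ty n → Ty n → Ty n
  μ    : Ty (suc n) → Ty n
  ▸    : Ty n → Ty n
  ■    : Ty 0 → Ty n

Guarded : ∀ {n} → Fin n → Ty n → Set
Guarded x (var y)  = y ≢ x
Guarded x `N       = ⊤
Guarded x `1       = ⊤
Guarded x (A ⊗ B)  = Guarded x A × Guarded x B
Guarded x `0       = ⊤
Guarded x (A ⊕ B)  = Guarded x A × Guarded x B
Guarded x (A ⇒ B)  = Guarded x A × Guarded x B
Guarded x (μ A)    = Guarded (suc x) A
Guarded x (▸ A)    = ⊤
Guarded x (■ A)    = ⊤   -- A is closed, so x does not occur

WF : ∀ {n} → Ty n → Set
WF (var y)  = ⊤
WF `N       = ⊤
WF `1       = ⊤
WF (A ⊗ B)  = WF A × WF B
WF `0       = ⊤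
WF (A ⊕ B)  = WF A × WF B
WF (A ⇒ B)  = WF A × WF B
WF (μ A)    = Guarded zero A × WF A
WF (▸ A)    = WF A
WF (■ A)    = WF A

ext : ∀ {m n} → (Fin m → Fin n) → Fin (suc m) → Fin (suc n)
ext ρ zero    = zero
ext ρ (suc i) = suc (ρ i)

rename : ∀ {m n} → (Fin m → Fin n) → Ty m → Ty n
rename ρ (var y)  = var (ρ y)
rename ρ `N       = `N
rename ρ `1       = `1
rename ρ (A ⊗ B)  = rename ρ A ⊗ rename ρ B
rename ρ `0       = `0
rename ρ (A ⊕ B)  = rename ρ A ⊕ rename ρ B
rename ρ (A ⇒ B)  = rename ρ A ⇒ rename ρ B
rename ρ (μ A)    = μ (rename (ext ρ) A)
rename ρ (▸ A)    = ▸ (rename ρ A)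
rename ρ (■ A)    = ■ A

exts : ∀ {m n} → (Fin m → Ty n) → Fin (suc m) → Ty (suc n)
exts σ zero    = var zero
exts σ (suc i) = rename suc (σ i)

subst : ∀ {m n} → (Fin m → Ty n) → Ty m → Ty n
subst σ (var y)  = σ y
subst σ `N       = `N
subst σ `1       = `1
subst σ (A ⊗ B)  = subst σ A ⊗ subst σ B
subst σ `0       = `0
subst σ (A ⊕ B)  = subst σ A ⊕ subst σ B
subst σ (A ⇒ B)  = subst σ A ⇒ subst σ B
subst σ (μ A)    = μ (subst (exts σ) A)
subst σ (▸ A)    = ▸ (subst σ A)
subst σ (■ A)    = ■ A

-- Substitution of B for the variable x: A[B/x].  The remaining variables are
-- renumbered (punchOut) since x disappears from the context.
single : ∀ {n} → Fin (suc n) → Ty n → Fin (suc n) → Ty n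
single x B y with x ≟ y
... | yes _   = B
... | no x≢y  = var (punchOut x≢y)

_[_/_] : ∀ {n} → Ty (suc n) → Ty n → Fin (suc n) → Ty n
A [ B / x ] = subst (single x B) A

us : ∀ {n} → Ty n → ℕ
us (var y)  = 1
us `N       = 1
us `1       = 1
us (A ⊗ B)  = suc (us A + us B)
us `0       = 1
us (A ⊕ B)  = suc (us A + us B)
us (A ⇒ B)  = suc (us A + us B)
us (μ A)    = suc (us A)
us (▸ A)    = 0
us (■ A)    = suc (us A)

bd : ∀ {n} → Ty n → ℕ
bd (var y)  = 0
bd `N       = 0
bd `1       = 0
bd (A ⊗ B)  = bd A ⊓ bd B
bd `0       = 0
bd (A ⊕ B)  = bd A ⊓ bd B
bd (A ⇒ B)  = bd A ⊓ bd B
bd (μ A)    = bd A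
bd (▸ A)    = bd A
bd (■ A)    = suc (bd A)

module Submission where

-- Both parts are proved for an arbitrary simultaneous substitution σ, since
-- going under μ turns the single substitution [B/α] into its lifting, which
-- is no longer of that form.
--   * Renaming leaves us and bd unchanged, so lifting σ under a binder
--     preserves any bound on us or bd of its images.
--   * (i) If σ sends every variable other than x to a type of unguarded size
--     at most 1 and x is guarded in A, then us (A[σ]) ≤ us A: unguarded
--     variable occurrences are all ≠ x, and occurrences of x lie beneath ▸,
--     where us is 0 whatever is substituted.
--   * (ii) If every image of σ has box depth at most bd A, then
--     bd (A[σ]) ≤ bd A, since bd is a minimum taken over the leaves of A.
-- The theorem follows by checking both hypotheses for σ = [B/α].

open import Defs
open import Data.Nat using (ℕ; suc; _≤_; _+_; _⊓_; z≤n; s≤s)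
open import Data.Nat.Properties using (≤-refl; ≤-trans; +-mono-≤; ⊓-mono-≤; m⊓n≤m; m⊓n≤n)
open import Data.Fin using (Fin; zero; suc)
open import Data.Fin.Properties using (_≟_)
open import Data.Product using (_×_; _,_)
open import Data.Empty using (⊥-elim)
open import Relation.Nullary using (yes; no)
open import Relation.Binary.PropositionalEquality using (_≡_; refl; _≢_; cong; cong₂; sym)

us-rename : ∀ {m n} (ρ : Fin m → Fin n) (A : Ty m) → us (rename ρ A) ≡ us A
us-rename ρ (var y)  = refl
us-rename ρ `N       = refl
us-rename ρ `1       = refl
us-rename ρ (A ⊗ B)  = cong suc (cong₂ _+_ (us-rename ρ A) (us-rename ρ B))
us-rename ρ `0       = refl
us-rename ρ (A ⊕ B)  = cong suc (cong₂ _+_ (us-rename ρ A) (us-rename ρ B))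
us-rename ρ (A ⇒ B)  = cong suc (cong₂ _+_ (us-rename ρ A) (us-rename ρ B))
us-rename ρ (μ A)    = cong suc (us-rename (ext ρ) A)
us-rename ρ (▸ A)    = refl
us-rename ρ (■ A)    = refl

bd-rename : ∀ {m n} (ρ : Fin m → Fin n) (A : Ty m) → bd (rename ρ A) ≡ bd A
bd-rename ρ (var y)  = refl
bd-rename ρ `N       = refl
bd-rename ρ `1       = refl
bd-rename ρ (A ⊗ B)  = cong₂ _⊓_ (bd-rename ρ A) (bd-rename ρ B)
bd-rename ρ `0       = refl
bd-rename ρ (A ⊕ B)  = cong₂ _⊓_ (bd-rename ρ A) (bd-rename ρ B)
bd-rename ρ (A ⇒ B)  = cong₂ _⊓_ (bd-rename ρ A) (bd-rename ρ B)
bd-rename ρ (μ A)    = bd-rename (ext ρ) A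
bd-rename ρ (▸ A)    = bd-rename ρ A
bd-rename ρ (■ A)    = refl

SmallAwayFrom : ∀ {m n} → (Fin m → Ty n) → Fin m → Set
SmallAwayFrom σ x = ∀ y → y ≢ x → us (σ y) ≤ 1

exts-small : ∀ {m n} (σ : Fin m → Ty n) (x : Fin m) →
  SmallAwayFrom σ x → SmallAwayFrom (exts σ) (suc x)
exts-small σ x small zero    _     = ≤-refl
exts-small σ x small (suc y) y≢x rewrite us-rename suc (σ y) =
  small y (λ y≡x → y≢x (cong suc y≡x))

us-subst : ∀ {m n} (σ : Fin m → Ty n) (x : Fin m) (A : Ty m) →
  SmallAwayFrom σ x → Guarded x A → us (subst σ A) ≤ us A
us-subst σ x (var y) small y≢x       = small y y≢x
us-subst σ x `N      small _         = ≤-refl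
us-subst σ x `1      small _         = ≤-refl
us-subst σ x (A ⊗ B) small (gA , gB) = s≤s (+-mono-≤ (us-subst σ x A small gA) (us-subst σ x B small gB))
us-subst σ x `0      small _         = ≤-refl
us-subst σ x (A ⊕ B) small (gA , gB) = s≤s (+-mono-≤ (us-subst σ x A small gA) (us-subst σ x B small gB))
us-subst σ x (A ⇒ B) small (gA , gB) = s≤s (+-mono-≤ (us-subst σ x A small gA) (us-subst σ x B small gB))
us-subst σ x (μ A)   small g         = s≤s (us-subst (exts σ) (suc x) A (exts-small σ x small) g)
us-subst σ x (▸ A)   small _         = z≤n
us-subst σ x (■ A)   small _         = ≤-refl

DepthBounded : ∀ {m n} → (Fin m → Ty n) → ℕ → Set
DepthBounded σ k = ∀ y → bd (σ y) ≤ k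

depth-relax : ∀ {m n} (σ : Fin m → Ty n) {k l : ℕ} →
  DepthBounded σ k → k ≤ l → DepthBounded σ l
depth-relax σ bounded k≤l y = ≤-trans (bounded y) k≤l

-- Lifting under a binder preserves a depth bound: the new variable has
-- depth 0 and the old images are only renamed.
exts-depth : ∀ {m n} (σ : Fin m → Ty n) {k : ℕ} →
  DepthBounded σ k → DepthBounded (exts σ) k
exts-depth σ bounded zero    = z≤n
exts-depth σ bounded (suc y) rewrite bd-rename suc (σ y) = bounded y

-- Part (ii) for simultaneous substitutions, by mutual recursion with the
-- common case of ⊗, ⊕ and ⇒, where bd is the minimum of the operands' depths.
bd-subst : ∀ {m n} (σ : Fin m → Ty n) (A : Ty m) →
  DepthBounded σ (bd A) → bd (subst σ A) ≤ bd A
bd-subst-binary : ∀ {m n} (σ : Fin m → Ty n) (A B : Ty m) →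
  DepthBounded σ (bd A ⊓ bd B) → bd (subst σ A) ⊓ bd (subst σ B) ≤ bd A ⊓ bd B

bd-subst σ (var y) bounded = bounded y
bd-subst σ `N      _       = ≤-refl
bd-subst σ `1      _       = ≤-refl
bd-subst σ (A ⊗ B) bounded = bd-subst-binary σ A B bounded
bd-subst σ `0      _       = ≤-refl
bd-subst σ (A ⊕ B) bounded = bd-subst-binary σ A B bounded
bd-subst σ (A ⇒ B) bounded = bd-subst-binary σ A B bounded
bd-subst σ (μ A)   bounded = bd-subst (exts σ) A (exts-depth σ bounded)
bd-subst σ (▸ A)   bounded = bd-subst σ A bounded
bd-subst σ (■ A)   _       = ≤-refl

bd-subst-binary σ A B bounded =
  ⊓-mono-≤ (bd-subst σ A (depth-relax σ bounded (m⊓n≤m (bd A) (bd B))))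
           (bd-subst σ B (depth-relax σ bounded (m⊓n≤n (bd A) (bd B))))

-- The single substitution [B/x] is small away from x: it sends every other
-- variable to a variable.
single-small : ∀ {n} (x : Fin (suc n)) (B : Ty n) → SmallAwayFrom (single x B) x
single-small x B y y≢x with x ≟ y
... | yes x≡y = ⊥-elim (y≢x (sym x≡y))
... | no  _   = ≤-refl

-- The images of [B/x] are B and variables, so their depth is at most bd B.
single-depth : ∀ {n} (x : Fin (suc n)) (B : Ty n) → DepthBounded (single x B) (bd B)
single-depth x B y with x ≟ y
... | yes _ = ≤-refl
... | no  _ = z≤n

lemma2p11 : ∀ {n} (A : Ty (suc n)) (B : Ty n) (α : Fin (suc n)) → WF A → WF B →
    (Guarded α A → us (A [ B / α ]) ≤ us A) ×
    (bd B ≤ bd A → bd (A [ B / α ]) ≤ bd A)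
lemma2p11 A B α _ _ = part-i , part-ii
  where
  part-i : Guarded α A → us (A [ B / α ]) ≤ us A
  part-i = us-subst (single α B) α A (single-small α B)

  part-ii : bd B ≤ bd A → bd (A [ B / α ]) ≤ bd A
  part-ii bdB≤bdA = bd-subst (single α B) A (depth-relax (single α B) (single-depth α B) bdB≤bdA)
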